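{- $$F_{\{231,321\}}(x,q,z)=\frac{1-z}{1-(x+1)z+(x-q)z^2}.$$
   Context: For permutations $\pi=\pi_1\cdots\pi_n\in\mathfrak{S}_n$ and $\sigma\in\mathfrak{S}_m$, $\pi$ contains $\sigma$ if there are indices $i_1<\dots<i_m$ such that $\pi_{i_1}\cdots\pi_{i_m}$ is in the same relative order as $\sigma$; otherwise $\pi$ avoids $\sigma$. For a set $\Sigma$ of patterns, $\mathfrak{S}_n(\Sigma)$ is the set of permutations in $\mathfrak{S}_n$ avoiding every pattern in $\Sigma$. $\mathrm{fp}(\pi)=|\{i:\pi_i=i\}|$, $\mathrm{exc}(\pi)=|\{i:\pi_i>i\}|$, and $F_\Sigma(x,q,z)=\sum_{n\ge0}\sum_{\pi\in\mathfrak{S}_n(\Sigma)}x^{\mathrm{fp}(\pi)}q^{\mathrm{exc}(\pi)}z^n$. -}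

module Defs where

open import Data.Nat using (ℕ; zero; suc; _<ᵇ_; _≡ᵇ_)
open import Data.Bool using (Bool; true; false; _∧_; _∨_; not; if_then_else_)
open import Data.List using (List; []; _∷_; map; concatMap; filter; foldr; length; zip; upTo)
open import Data.Bool.ListAction using (all; any)
open import Data.Product using (_,_; _×_)
open import Relation.Nullary.Decidable using (does)
open import Data.Bool.Properties using (T?)
open import Algebra.Bundles using (CommutativeRing)

-- Permutations of length n are represented in one-line notation as lists
-- π₁ … πₙ of natural numbers, with values in {1,…,n} and all distinct.

oneTo : ℕ → List ℕ
oneTo n = map suc (upTo n)

words : ℕ → ℕ → List (List ℕ)
words n zero    = [] ∷ []
words n (suc k) = concatMap (λ a → map (a ∷_) (words n k)) (oneTo n)

distinct : List ℕ → Bool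
distinct []       = true
distinct (a ∷ as) = all (λ b → not (a ≡ᵇ b)) as ∧ distinct as

perms : ℕ → List (List ℕ)
perms n = filter (λ w → T? (distinct w)) (words n n)

subseqs : List ℕ → List (List ℕ)
subseqs []       = [] ∷ []
subseqs (a ∷ as) = map (a ∷_) (subseqs as) Data.List.++ subseqs as

iff : Bool → Bool → Bool
iff a b = (a ∧ b) ∨ (not a ∧ not b)

sameOrder : List ℕ → List ℕ → Bool
sameOrder []       []       = true
sameOrder (u ∷ us) (v ∷ vs) =
  all (λ p → iff (u <ᵇ Data.Product.proj₁ p) (v <ᵇ Data.Product.proj₂ p)
           ∧ iff (Data.Product.proj₁ p <ᵇ u) (Data.Product.proj₂ p <ᵇ v))
      (zip us vs)
  ∧ sameOrder us vs
sameOrder _ _ = false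

contains : List ℕ → List ℕ → Bool
contains π σ = any (sameOrder σ) (subseqs π)

avoidsAll : List (List ℕ) → List ℕ → Bool
avoidsAll Σ π = all (λ σ → not (contains π σ)) Σ

avoiders : List (List ℕ) → ℕ → List (List ℕ)
avoiders Σ n = filter (λ π → T? (avoidsAll Σ π)) (perms n)

count : (ℕ × ℕ → Bool) → List (ℕ × ℕ) → ℕ
count p []       = 0
count p (x ∷ xs) = if p x then suc (count p xs) else count p xs

indexed : List ℕ → List (ℕ × ℕ)
indexed π = zip π (oneTo (length π))

fp : List ℕ → ℕ
fp π = count (λ p → Data.Product.proj₁ p ≡ᵇ Data.Product.proj₂ p) (indexed π)

exc : List ℕ → ℕ
exc π = count (λ p → Data.Product.proj₂ p <ᵇ Data.Product.proj₁ p) (indexed π)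

module _ {c ℓ} (R : CommutativeRing c ℓ) where
  open CommutativeRing R

  pow : Carrier → ℕ → Carrier
  pow a zero    = 1#
  pow a (suc k) = a * pow a k

  -- coefficient of zⁿ in F_Σ(x,q,z), evaluated in R:
  --   Σ_{π ∈ 𝔖ₙ(Σ)} x^fp(π) q^exc(π)
  Fcoef : List (List ℕ) → Carrier → Carrier → ℕ → Carrier
  Fcoef Σ x q n = foldr (λ π acc → pow x (fp π) * pow q (exc π) + acc) 0# (avoiders Σ n)

Σ231-321 : List (List ℕ)
Σ231-321 = (2 ∷ 3 ∷ 1 ∷ []) ∷ (3 ∷ 2 ∷ 1 ∷ []) ∷ []

{-# OPTIONS --safe #-}
module Submission where

-- A permutation avoids 231 and 321 iff no entry is preceded by two distinct larger
-- entries. So for k ≥ 1 the last entry of π ∈ 𝔖ₖ₊₁(231,321) is k+1 or k, and π is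
-- either σ(k+1) or σ′k, where σ ∈ 𝔖ₖ(231,321) and σ′ is σ with its entry k renamed
-- to k+1; this is a bijection from two copies of 𝔖ₖ(231,321). Appending k+1 adds a
-- fixed point, so F(k+1) = x F(k) + G(k), where G(k) is the total weight of the σ′k.
-- Decomposing σ in the same way, (τ(k+1))′(k+1) = τ(k+2)(k+1) has one excedance more
-- than τ, while (τ′k)′(k+1) has the weight of τ′k; so G(k+1) = q F(k) + G(k).
-- Eliminating G gives F(k+2) + x F(k) = (x+1) F(k+1) + q F(k), which for k = 0 is
-- checked directly.

open import Defs
open import Algebra.Bundles using (CommutativeRing)
open import Data.Bool using (true; false; T; not; _∧_; if_then_else_)
open import Data.Bool.Properties using (T?; T-∧; T-≡; T-not-≡)
open import Data.List
  using (List; []; _∷_; [_]; _++_; _∷ʳ_; map; foldr; length; upTo; zip; concatMap; cartesianProductWith)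
open import Data.List.Properties
  using (length-map; length-upTo; length-++; length-++-sucʳ; upTo-∷ʳ; map-++; map-∘; map-cong; map-id;
         map-id-local; foldr-map; ++-identityʳ; ++-assoc; ∷-injective; ∷ʳ-injective; ∷ʳ-injectiveˡ;
         ∷ʳ-injectiveʳ)
open import Data.List.Membership.Propositional using (_∈_; find; lose)
open import Data.List.Membership.Propositional.Properties
  using (∈-map⁺; ∈-map⁻; ∈-upTo⁺; ∈-upTo⁻; ∈-filter⁺; ∈-filter⁻; ∈-∃++; ∈-++⁺ˡ; ∈-++⁺ʳ; ∈-++⁻;
         ∈-cartesianProductWith⁺; ∈-cartesianProductWith⁻)
open import Data.List.Membership.Propositional.Properties.WithK using (unique∧set⇒bag)
open import Data.List.Relation.Binary.BagAndSetEquality using (∼bag⇒↭)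
open import Data.List.Relation.Binary.Disjoint.Propositional using (Disjoint)
open import Data.List.Relation.Binary.Permutation.Propositional
  using (_↭_; ↭-refl; ↭-sym; ↭-trans; ↭-swap; ↭⇒↭ₛ; ↭⇒↭ₛ′; module PermutationReasoning)
open import Data.List.Relation.Binary.Permutation.Propositional.Properties
  using (∈-resp-↭; ↭-length; drop-mid; ++⁺ʳ; ++⁺ˡ; map⁺)
import Data.List.Relation.Binary.Permutation.Setoid.Properties as Permutationₛ
import Data.List.Relation.Binary.Sublist.Propositional as Sublist
import Data.List.Relation.Binary.Sublist.Propositional.Properties as Sublistₚ
open Sublist using (_⊆_; []; _∷_)
open import Data.List.Reverse using (Reverse; reverseView; []; _∶_∶ʳ_)
open import Data.List.Relation.Unary.All as All using (All; []; _∷_)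
open import Data.List.Relation.Unary.All.Properties using (all⁺; all⁻)
open import Data.List.Relation.Unary.AllPairs using ([]; _∷_)
open import Data.List.Relation.Unary.Any using (here; there)
open import Data.List.Relation.Unary.Any.Properties using (any⁺; any⁻)
open import Data.List.Relation.Unary.Unique.Propositional using (Unique)
import Data.List.Relation.Unary.Unique.Propositional.Properties as Unique
open import Data.Nat using (ℕ; zero; suc; _<_; _≤_; _≟_; _≡ᵇ_; _<ᵇ_; s≤s; z≤n)
open import Data.Nat.Properties
  using (suc-injective; _<?_; ≡ᵇ⇒≡; ≡⇒≡ᵇ; <ᵇ⇒<; <⇒<ᵇ; ≤-refl; ≤-reflexive; ≤-trans; <-trans; ≤-<-trans;
         <-≤-trans; <-cmp; n≮n; 1+n≢n; <⇒≤; <⇒≢; <⇒≯; <⇒≱; ≤⇒≯; n<1+n; n≤1+n; m<n⇒m<1+n; m≤n⇒m≤1+n;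
         m≤n⇒m<n∨m≡n; +-comm)
open import Data.Product using (_×_; _,_; ∃-syntax; proj₁; proj₂)
open import Data.Sum using (_⊎_; inj₁; inj₂)
open import Function.Base using (_∘_)
open import Function.Bundles using (_⇔_; mk⇔; Equivalence)
open import Relation.Binary.Definitions using (DecidableEquality; tri<; tri≈; tri>)
open import Relation.Binary.PropositionalEquality
  using (_≡_; _≢_; refl; sym; trans; cong; cong₂; subst; subst₂; module ≡-Reasoning)
  renaming (setoid to ≡-setoid)
open import Relation.Nullary using (¬_; yes; no; contradiction)
open import Relation.Nullary.Decidable using (dec-true; dec-false)

private
  variable
    A B C : Set
    n v : ℕ
    π : List ℕ

T-not⇔¬ : ∀ {b} → T (not b) ⇔ (¬ T b)
T-not⇔¬ {false} = mk⇔ (λ _ ()) _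
T-not⇔¬ {true}  = mk⇔ (λ ()) (λ ¬t → ¬t _)

T-iff⇔≡ : ∀ {a b} → T (iff a b) ⇔ (a ≡ b)
T-iff⇔≡ {false} {false} = mk⇔ (λ _ → refl) _
T-iff⇔≡ {false} {true}  = mk⇔ (λ ()) (λ ())
T-iff⇔≡ {true}  {false} = mk⇔ (λ ()) (λ ())
T-iff⇔≡ {true}  {true}  = mk⇔ (λ _ → refl) _

T-not-≡ᵇ⇔≢ : ∀ m n → T (not (m ≡ᵇ n)) ⇔ (m ≢ n)
T-not-≡ᵇ⇔≢ m n = mk⇔ (λ t → Equivalence.to T-not⇔¬ t ∘ ≡⇒≡ᵇ m n)
                     (λ m≢n → Equivalence.from T-not⇔¬ (m≢n ∘ ≡ᵇ⇒≡ m n))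

≡ᵇ-true : ∀ {m n} → m ≡ n → (m ≡ᵇ n) ≡ true
≡ᵇ-true {m} {n} m≡n = Equivalence.to T-≡ (≡⇒≡ᵇ m n m≡n)

≡ᵇ-false : ∀ {m n} → m ≢ n → (m ≡ᵇ n) ≡ false
≡ᵇ-false {m} {n} m≢n = Equivalence.to T-not-≡ (Equivalence.from (T-not-≡ᵇ⇔≢ m n) m≢n)

<ᵇ-true : ∀ {m n} → m < n → (m <ᵇ n) ≡ true
<ᵇ-true {m} {n} = dec-true (m <? n)

<ᵇ-false : ∀ {m n} → n ≤ m → (m <ᵇ n) ≡ false
<ᵇ-false {m} {n} n≤m = dec-false (m <? n) (≤⇒≯ n≤m)

∈-++-∷⁻ : ∀ {x y : A} xs {ys} → x ∈ xs ++ y ∷ ys → x ≢ y → x ∈ xs ++ ys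
∈-++-∷⁻ xs p x≢y with ∈-++⁻ xs p
... | inj₁ p          = ∈-++⁺ˡ p
... | inj₂ (here x≡y) = contradiction x≡y x≢y
... | inj₂ (there p)  = ∈-++⁺ʳ xs p

∈-∷ʳ⁻ : ∀ {x y : A} {xs} → x ∈ xs ∷ʳ y → x ≢ y → x ∈ xs
∈-∷ʳ⁻ {xs = xs} x∈ x≢y = subst (_ ∈_) (++-identityʳ xs) (∈-++-∷⁻ xs x∈ x≢y)

unique⇒length≤ : ∀ {xs ys : List A} → Unique xs → (∀ {x} → x ∈ xs → x ∈ ys) → length xs ≤ length ys
unique⇒length≤ [] _ = z≤n
unique⇒length≤ {xs = x ∷ xs} (x∉xs ∷ u) xs⊆ys with ∈-∃++ (xs⊆ys (here refl))
... | as , bs , refl = subst (suc (length xs) ≤_) (sym (length-++-sucʳ as x bs))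
  (s≤s (unique⇒length≤ u λ z∈xs → ∈-++-∷⁻ as (xs⊆ys (there z∈xs)) λ { refl → All.lookup x∉xs z∈xs refl }))

module _ {A : Set} (_≟ᴬ_ : DecidableEquality A) where
  open import Data.List.Membership.DecPropositional _≟ᴬ_ using (_∈?_)

  unique⇒covers : ∀ {xs ys : List A} → Unique xs → (∀ {x} → x ∈ xs → x ∈ ys) →
                  length ys ≤ length xs → ∀ {y} → y ∈ ys → y ∈ xs
  unique⇒covers {xs} u xs⊆ys ys≤xs {y} y∈ys with y ∈? xs
  ... | yes y∈xs = y∈xs
  ... | no y∉xs with ∈-∃++ y∈ys
  ...   | as , bs , refl =
    contradiction (≤-trans (s≤s xs≤) (subst (_≤ length xs) (length-++-sucʳ as y bs) ys≤xs)) (n≮n _)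
    where
    xs≤ : length xs ≤ length (as ++ bs)
    xs≤ = unique⇒length≤ u (λ x∈xs → ∈-++-∷⁻ as (xs⊆ys x∈xs) λ { refl → y∉xs x∈xs })

length-oneTo : ∀ n → length (oneTo n) ≡ n
length-oneTo n = trans (length-map suc (upTo n)) (length-upTo n)

oneTo-suc : ∀ n → oneTo (suc n) ≡ oneTo n ∷ʳ suc n
oneTo-suc n = trans (cong (map suc) (sym (upTo-∷ʳ n))) (map-++ suc (upTo n) [ n ])

oneTo-suc-suc : ∀ n → oneTo (suc (suc n)) ≡ oneTo n ++ suc n ∷ suc (suc n) ∷ []
oneTo-suc-suc n = trans (oneTo-suc (suc n))
  (trans (cong (_∷ʳ suc (suc n)) (oneTo-suc n)) (++-assoc (oneTo n) [ suc n ] [ suc (suc n) ]))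

∈-oneTo⇔ : (v ∈ oneTo n) ⇔ (0 < v × v ≤ n)
∈-oneTo⇔ {v} {n} = mk⇔ to from
  where
  to : v ∈ oneTo n → 0 < v × v ≤ n
  to p with ∈-map⁻ suc p
  ... | i , i∈ , refl = s≤s z≤n , ∈-upTo⁻ i∈
  from : 0 < v × v ≤ n → v ∈ oneTo n
  from (s≤s z≤n , v≤n) = ∈-map⁺ suc (∈-upTo⁺ v≤n)

oneTo-unique : ∀ n → Unique (oneTo n)
oneTo-unique n = Unique.map⁺ suc-injective (Unique.upTo⁺ n)

concatMap≡cartesianProductWith : ∀ (f : A → B → C) xs ys →
                                 concatMap (λ a → map (f a) ys) xs ≡ cartesianProductWith f xs ys
concatMap≡cartesianProductWith f []       ys = refl
concatMap≡cartesianProductWith f (x ∷ xs) ys =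
  cong (map (f x) ys ++_) (concatMap≡cartesianProductWith f xs ys)

words-suc : ∀ n k → words n (suc k) ≡ cartesianProductWith _∷_ (oneTo n) (words n k)
words-suc n k = concatMap≡cartesianProductWith _∷_ (oneTo n) (words n k)

∈-words⁻ : ∀ n k → π ∈ words n k → length π ≡ k × All (_∈ oneTo n) π
∈-words⁻ n zero (here refl) = refl , []
∈-words⁻ n (suc k) p rewrite words-suc n k
  with ∈-cartesianProductWith⁻ _∷_ (oneTo n) (words n k) p
... | a , π , a∈ , π∈ , refl with ∈-words⁻ n k π∈
...   | length≡k , π⊆ = cong suc length≡k , a∈ ∷ π⊆

∈-words⁺ : ∀ n k → length π ≡ k → All (_∈ oneTo n) π → π ∈ words n k
∈-words⁺ n zero    refl []        = here refl
∈-words⁺ n (suc k) refl (a∈ ∷ π⊆) rewrite words-suc n k =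
  ∈-cartesianProductWith⁺ _∷_ a∈ (∈-words⁺ n k refl π⊆)

words-unique : ∀ n k → Unique (words n k)
words-unique n zero    = [] ∷ []
words-unique n (suc k) rewrite words-suc n k =
  Unique.cartesianProductWith⁺ _∷_ ∷-injective (oneTo-unique n) (words-unique n k)

distinct⇔Unique : ∀ π → T (distinct π) ⇔ Unique π
distinct⇔Unique π = mk⇔ (to π) (from π)
  where
  to : ∀ π → T (distinct π) → Unique π
  to []       _ = []
  to (a ∷ as) t with Equivalence.to T-∧ t
  ... | fresh , t′ =
    All.map (Equivalence.to (T-not-≡ᵇ⇔≢ a _)) (all⁺ (λ b → not (a ≡ᵇ b)) as fresh) ∷ to as t′
  from : ∀ π → Unique π → T (distinct π)
  from []       _           = _
  from (a ∷ as) (fresh ∷ u) = Equivalence.from T-∧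
    (all⁻ (λ b → not (a ≡ᵇ b)) (All.map (Equivalence.from (T-not-≡ᵇ⇔≢ a _)) fresh) , from as u)

∈-perms⇔ : (π ∈ perms n) ⇔ (π ↭ oneTo n)
∈-perms⇔ {π} {n} = mk⇔ to from
  where
  to : π ∈ perms n → π ↭ oneTo n
  to p with ∈-filter⁻ (λ w → T? (distinct w)) {xs = words n n} p
  ... | π∈ , d with ∈-words⁻ n n π∈
  ...   | length≡n , π⊆oneTo =
    ∼bag⇒↭ (unique∧set⇒bag uπ (oneTo-unique n) (mk⇔ (All.lookup π⊆oneTo) oneTo⊆π))
    where
    uπ = Equivalence.to (distinct⇔Unique π) d
    oneTo⊆π : ∀ {v} → v ∈ oneTo n → v ∈ π
    oneTo⊆π = unique⇒covers _≟_ uπ (All.lookup π⊆oneTo) (≤-reflexive (trans (length-oneTo n) (sym length≡n)))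
  from : π ↭ oneTo n → π ∈ perms n
  from p = ∈-filter⁺ (λ w → T? (distinct w)) (∈-words⁺ n n length≡n (All.tabulate (∈-resp-↭ p)))
                     (Equivalence.from (distinct⇔Unique π) uπ)
    where
    length≡n = trans (↭-length p) (length-oneTo n)
    uπ = Permutationₛ.Unique-resp-↭ (≡-setoid ℕ) (↭⇒↭ₛ (↭-sym p)) (oneTo-unique n)

↭-oneTo⇒length : ∀ {σ} → σ ↭ oneTo n → length σ ≡ n
↭-oneTo⇒length {n} p = trans (↭-length p) (length-oneTo n)

↭-oneTo⇒≤ : ∀ {σ} → σ ↭ oneTo n → v ∈ σ → v ≤ n
↭-oneTo⇒≤ p v∈σ = proj₂ (Equivalence.to ∈-oneTo⇔ (∈-resp-↭ p v∈σ))

∷ʳ-↭-oneTo⇔ : ∀ {σ} → (σ ∷ʳ suc n ↭ oneTo (suc n)) ⇔ (σ ↭ oneTo n)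
∷ʳ-↭-oneTo⇔ {n} {σ} = mk⇔
  (λ p → subst₂ _↭_ (++-identityʳ σ) (++-identityʳ (oneTo n))
                     (drop-mid σ (oneTo n) (subst (σ ∷ʳ suc n ↭_) (oneTo-suc n) p)))
  (λ p → subst (σ ∷ʳ suc n ↭_) (sym (oneTo-suc n)) (++⁺ʳ [ suc n ] p))

-- Pattern avoidance

∈-subseqs⇔ : ∀ {s} π → (s ∈ subseqs π) ⇔ (s ⊆ π)
∈-subseqs⇔ π = mk⇔ (to π) from
  where
  to : ∀ {s} π → s ∈ subseqs π → s ⊆ π
  to []       (here refl) = []
  to (a ∷ as) p with ∈-++⁻ (map (a ∷_) (subseqs as)) p
  ... | inj₂ p′ = a Sublist.∷ʳ to as p′
  ... | inj₁ p′ with ∈-map⁻ (a ∷_) p′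
  ...   | s , s∈ , refl = refl ∷ to as s∈
  from : ∀ {s π} → s ⊆ π → s ∈ subseqs π
  from []                           = here refl
  from (Sublist._∷ʳ_ {ys = as} a p) = ∈-++⁺ʳ (map (a ∷_) (subseqs as)) (from p)
  from (refl ∷ p)                   = ∈-++⁺ˡ (∈-map⁺ _ (from p))

Agree : ℕ × ℕ → ℕ × ℕ → Set
Agree (u , v) (u′ , v′) = ((u <ᵇ u′) ≡ (v <ᵇ v′)) × ((u′ <ᵇ u) ≡ (v′ <ᵇ v))

data SameOrder : List ℕ → List ℕ → Set where
  []  : SameOrder [] []
  _∷_ : ∀ {u v us vs} → All (Agree (u , v)) (zip us vs) → SameOrder us vs → SameOrder (u ∷ us) (v ∷ vs)

sameOrder⇔SameOrder : ∀ u v → T (sameOrder u v) ⇔ SameOrder u v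
sameOrder⇔SameOrder u v = mk⇔ (to u v) from
  where
  agree : ∀ u v p → T (iff (u <ᵇ proj₁ p) (v <ᵇ proj₂ p) ∧ iff (proj₁ p <ᵇ u) (proj₂ p <ᵇ v)) ⇔ Agree (u , v) p
  agree u v p = mk⇔
    (λ t → let l , r = Equivalence.to T-∧ t in Equivalence.to T-iff⇔≡ l , Equivalence.to T-iff⇔≡ r)
    (λ (l , r) → Equivalence.from T-∧ (Equivalence.from T-iff⇔≡ l , Equivalence.from T-iff⇔≡ r))
  to : ∀ u v → T (sameOrder u v) → SameOrder u v
  to []       []       _ = []
  to (u ∷ us) (v ∷ vs) t with Equivalence.to T-∧ t
  ... | agrees , t′ = All.map (Equivalence.to (agree u v _)) (all⁺ _ (zip us vs) agrees) ∷ to us vs t′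
  from : ∀ {u v} → SameOrder u v → T (sameOrder u v)
  from []                             = _
  from {u ∷ us} {v ∷ vs} (agrees ∷ s) =
    Equivalence.from T-∧ (all⁻ _ (All.map (Equivalence.from (agree u v _)) agrees) , from s)

agree⇒< : ∀ {u v u′ v′} → Agree (u , v) (u′ , v′) → u < u′ → v < v′
agree⇒< (u<u′≡v<v′ , _) u<u′ = <ᵇ⇒< _ _ (subst T u<u′≡v<v′ (<⇒<ᵇ u<u′))

agree⇒> : ∀ {u v u′ v′} → Agree (u , v) (u′ , v′) → u′ < u → v′ < v
agree⇒> (_ , u′<u≡v′<v) u′<u = <ᵇ⇒< _ _ (subst T u′<u≡v′<v (<⇒<ᵇ u′<u))

agree-< : ∀ {u v u′ v′} → u < u′ → v < v′ → Agree (u , v) (u′ , v′)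
agree-< u<u′ v<v′ = trans (<ᵇ-true u<u′) (sym (<ᵇ-true v<v′)) ,
                    trans (<ᵇ-false (<⇒≤ u<u′)) (sym (<ᵇ-false (<⇒≤ v<v′)))

agree-> : ∀ {u v u′ v′} → u′ < u → v′ < v → Agree (u , v) (u′ , v′)
agree-> u′<u v′<v = trans (<ᵇ-false (<⇒≤ u′<u)) (sym (<ᵇ-false (<⇒≤ v′<v))) ,
                    trans (<ᵇ-true u′<u) (sym (<ᵇ-true v′<v))

pattern231 pattern321 : List ℕ
pattern231 = 2 ∷ 3 ∷ 1 ∷ []
pattern321 = 3 ∷ 2 ∷ 1 ∷ []

sameOrder-231⁻ : ∀ {s} → T (sameOrder pattern231 s) → ∃[ a ] ∃[ b ] ∃[ c ] s ≡ a ∷ b ∷ c ∷ [] × c < a × a < b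
sameOrder-231⁻ {s} t with Equivalence.to (sameOrder⇔SameOrder pattern231 s) t
... | (ab ∷ ac ∷ []) ∷ _ ∷ [] ∷ [] = _ , _ , _ , refl , agree⇒> ac (n<1+n 1) , agree⇒< ab (n<1+n 2)

sameOrder-231⁺ : ∀ {a b c} → c < a → a < b → T (sameOrder pattern231 (a ∷ b ∷ c ∷ []))
sameOrder-231⁺ {a} {b} {c} c<a a<b = Equivalence.from (sameOrder⇔SameOrder pattern231 (a ∷ b ∷ c ∷ []))
  ((agree-< (n<1+n 2) a<b ∷ agree-> (n<1+n 1) c<a ∷ []) ∷
   (agree-> (<-trans (n<1+n 1) (n<1+n 2)) (<-trans c<a a<b) ∷ []) ∷ [] ∷ [])

sameOrder-321⁻ : ∀ {s} → T (sameOrder pattern321 s) → ∃[ a ] ∃[ b ] ∃[ c ] s ≡ a ∷ b ∷ c ∷ [] × c < b × b < a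
sameOrder-321⁻ {s} t with Equivalence.to (sameOrder⇔SameOrder pattern321 s) t
... | (ab ∷ _ ∷ []) ∷ (bc ∷ []) ∷ [] ∷ [] = _ , _ , _ , refl , agree⇒> bc (n<1+n 1) , agree⇒> ab (n<1+n 2)

sameOrder-321⁺ : ∀ {a b c} → c < b → b < a → T (sameOrder pattern321 (a ∷ b ∷ c ∷ []))
sameOrder-321⁺ {a} {b} {c} c<b b<a = Equivalence.from (sameOrder⇔SameOrder pattern321 (a ∷ b ∷ c ∷ []))
  ((agree-> (n<1+n 2) b<a ∷ agree-> (<-trans (n<1+n 1) (n<1+n 2)) (<-trans c<b b<a) ∷ []) ∷
   (agree-> (n<1+n 1) c<b ∷ []) ∷ [] ∷ [])

contains⇔ : ∀ π σ → T (contains π σ) ⇔ (∃[ s ] s ⊆ π × T (sameOrder σ s))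
contains⇔ π σ = mk⇔ to from
  where
  to : T (contains π σ) → ∃[ s ] s ⊆ π × T (sameOrder σ s)
  to t with find (any⁻ (sameOrder σ) (subseqs π) t)
  ... | s , s∈ , so = s , Equivalence.to (∈-subseqs⇔ π) s∈ , so
  from : ∃[ s ] s ⊆ π × T (sameOrder σ s) → T (contains π σ)
  from (s , s⊆π , so) = any⁺ (sameOrder σ) (lose (Equivalence.from (∈-subseqs⇔ π) s⊆π) so)

-- An occurrence a b c with c below a and b is one of 231 or 321, unless a = b.
Avoids : List ℕ → Set
Avoids π = ∀ {a b c} → a ∷ b ∷ c ∷ [] ⊆ π → c < a → c < b → a ≡ b

avoidsAll⇔Avoids : ∀ π → T (avoidsAll Σ231-321 π) ⇔ Avoids π
avoidsAll⇔Avoids π = mk⇔ to from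
  where
  occurs : ∀ σ {s} → s ⊆ π → T (sameOrder σ s) → T (contains π σ)
  occurs σ s⊆π so = Equivalence.from (contains⇔ π σ) (_ , s⊆π , so)
  no231 : Avoids π → ¬ T (contains π pattern231)
  no231 av t with Equivalence.to (contains⇔ π pattern231) t
  ... | s , s⊆π , so with sameOrder-231⁻ {s} so
  ...   | _ , _ , _ , refl , c<a , a<b = <⇒≢ a<b (av s⊆π c<a (<-trans c<a a<b))
  no321 : Avoids π → ¬ T (contains π pattern321)
  no321 av t with Equivalence.to (contains⇔ π pattern321) t
  ... | s , s⊆π , so with sameOrder-321⁻ {s} so
  ...   | _ , _ , _ , refl , c<b , b<a = <⇒≢ b<a (sym (av s⊆π (<-trans c<b b<a) c<b))
  from : Avoids π → T (avoidsAll Σ231-321 π)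
  from av = Equivalence.from T-∧
    (Equivalence.from T-not⇔¬ (no231 av) , Equivalence.from T-∧ (Equivalence.from T-not⇔¬ (no321 av) , _))
  to : T (avoidsAll Σ231-321 π) → Avoids π
  to t {a} {b} s⊆π c<a c<b with Equivalence.to (T-∧ {not (contains π pattern231)}) t
  ... | ¬231 , t′ with Equivalence.to (T-∧ {not (contains π pattern321)}) t′
  ...   | ¬321 , _ with <-cmp a b
  ...     | tri< a<b _ _ =
    contradiction (occurs pattern231 s⊆π (sameOrder-231⁺ c<a a<b)) (Equivalence.to T-not⇔¬ ¬231)
  ...     | tri≈ _ a≡b _ = a≡b
  ...     | tri> _ _ b<a =
    contradiction (occurs pattern321 s⊆π (sameOrder-321⁺ c<b b<a)) (Equivalence.to T-not⇔¬ ¬321)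

AtMostOneAbove : ℕ → List ℕ → Set
AtMostOneAbove c σ = ∀ {a b} → a ∈ σ → b ∈ σ → c < a → c < b → a ≡ b

⊆-∷ʳ⁻ : ∀ {xs ys : List A} {y} → xs ⊆ ys ∷ʳ y → xs ⊆ ys ⊎ ∃[ xs′ ] xs ≡ xs′ ∷ʳ y × xs′ ⊆ ys
⊆-∷ʳ⁻ {ys = []}     (y Sublist.∷ʳ []) = inj₁ []
⊆-∷ʳ⁻ {ys = []}     (refl ∷ [])       = inj₂ ([] , refl , [])
⊆-∷ʳ⁻ {ys = y ∷ ys} (y Sublist.∷ʳ p) with ⊆-∷ʳ⁻ p
... | inj₁ q                = inj₁ (y Sublist.∷ʳ q)
... | inj₂ (xs′ , refl , q) = inj₂ (xs′ , refl , y Sublist.∷ʳ q)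
⊆-∷ʳ⁻ {ys = y ∷ ys} (refl ∷ p) with ⊆-∷ʳ⁻ p
... | inj₁ q                = inj₁ (refl ∷ q)
... | inj₂ (xs′ , refl , q) = inj₂ (y ∷ xs′ , refl , refl ∷ q)

⊆-pair : ∀ {a b : A} {xs} → a ∈ xs → b ∈ xs → a ≢ b → a ∷ b ∷ [] ⊆ xs ⊎ b ∷ a ∷ [] ⊆ xs
⊆-pair (here refl)  (here refl)  a≢b = contradiction refl a≢b
⊆-pair (here refl)  (there b∈xs) _   = inj₁ (refl ∷ Sublist.from∈ b∈xs)
⊆-pair (there a∈xs) (here refl)  _   = inj₂ (refl ∷ Sublist.from∈ a∈xs)
⊆-pair {xs = x ∷ _} (there a∈xs) (there b∈xs) a≢b with ⊆-pair a∈xs b∈xs a≢b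
... | inj₁ p = inj₁ (x Sublist.∷ʳ p)
... | inj₂ p = inj₂ (x Sublist.∷ʳ p)

avoids-∷ʳ⇔ : ∀ {σ c} → Avoids (σ ∷ʳ c) ⇔ (Avoids σ × AtMostOneAbove c σ)
avoids-∷ʳ⇔ {σ} {c} = mk⇔ to from
  where
  to : Avoids (σ ∷ʳ c) → Avoids σ × AtMostOneAbove c σ
  to av = (λ s → av (Sublistₚ.++⁺ʳ [ c ] s)) , atMostOne
    where
    atMostOne : AtMostOneAbove c σ
    atMostOne {a} {b} a∈σ b∈σ c<a c<b with a ≟ b
    ... | yes a≡b = a≡b
    ... | no a≢b with ⊆-pair a∈σ b∈σ a≢b
    ...   | inj₁ ab⊆σ = av (Sublistₚ.++⁺ ab⊆σ Sublist.⊆-refl) c<a c<b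
    ...   | inj₂ ba⊆σ = sym (av (Sublistₚ.++⁺ ba⊆σ Sublist.⊆-refl) c<b c<a)
  from : Avoids σ × AtMostOneAbove c σ → Avoids (σ ∷ʳ c)
  from (av , atMostOne) {a} {b} s c′<a c′<b with ⊆-∷ʳ⁻ s
  ... | inj₁ s′ = av s′ c′<a c′<b
  ... | inj₂ (xs′ , eq , s′) with ∷ʳ-injective (a ∷ b ∷ []) xs′ eq
  ...   | refl , refl =
    atMostOne (Sublist.lookup s′ (here refl)) (Sublist.lookup s′ (there (here refl))) c′<a c′<b

⊆-map⁻ : ∀ (f : A → B) {xs ys} → xs ⊆ map f ys → ∃[ zs ] zs ⊆ ys × xs ≡ map f zs
⊆-map⁻ f {ys = []}     []               = [] , [] , refl
⊆-map⁻ f {ys = y ∷ ys} (_ Sublist.∷ʳ p) with ⊆-map⁻ f p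
... | zs , q , refl = zs , y Sublist.∷ʳ q , refl
⊆-map⁻ f {ys = y ∷ ys} (refl ∷ p) with ⊆-map⁻ f p
... | zs , q , refl = y ∷ zs , refl ∷ q , refl

StrictlyMonotoneOn : List ℕ → (ℕ → ℕ) → Set
StrictlyMonotoneOn τ f = ∀ {v w} → v ∈ τ → w ∈ τ → v < w → f v < f w

module _ {τ f} (mono : StrictlyMonotoneOn τ f) where

  monotone-reflects-< : ∀ {v w} → v ∈ τ → w ∈ τ → f v < f w → v < w
  monotone-reflects-< {v} {w} v∈τ w∈τ fv<fw with <-cmp v w
  ... | tri< v<w _ _  = v<w
  ... | tri≈ _ refl _ = contradiction fv<fw (n≮n _)
  ... | tri> _ _ w<v  = contradiction (mono w∈τ v∈τ w<v) (<⇒≯ fv<fw)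

  monotone-injective : ∀ {v w} → v ∈ τ → w ∈ τ → f v ≡ f w → v ≡ w
  monotone-injective {v} {w} v∈τ w∈τ fv≡fw with <-cmp v w
  ... | tri< v<w _ _ = contradiction fv≡fw (<⇒≢ (mono v∈τ w∈τ v<w))
  ... | tri≈ _ v≡w _ = v≡w
  ... | tri> _ _ w<v = contradiction (sym fv≡fw) (<⇒≢ (mono w∈τ v∈τ w<v))

  avoids-map⇔ : Avoids τ ⇔ Avoids (map f τ)
  avoids-map⇔ = mk⇔ to from
    where
    to : Avoids τ → Avoids (map f τ)
    to av s c<a c<b with ⊆-map⁻ f s
    ... | a ∷ b ∷ c ∷ [] , s′ , refl =
      cong f (av s′ (monotone-reflects-< c∈τ a∈τ c<a) (monotone-reflects-< c∈τ b∈τ c<b))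
      where
      a∈τ = Sublist.lookup s′ (here refl)
      b∈τ = Sublist.lookup s′ (there (here refl))
      c∈τ = Sublist.lookup s′ (there (there (here refl)))
    from : Avoids (map f τ) → Avoids τ
    from av s c<a c<b =
      monotone-injective a∈τ b∈τ (av (Sublistₚ.map⁺ f s) (mono c∈τ a∈τ c<a) (mono c∈τ b∈τ c<b))
      where
      a∈τ = Sublist.lookup s (here refl)
      b∈τ = Sublist.lookup s (there (here refl))
      c∈τ = Sublist.lookup s (there (there (here refl)))

-- Decomposition by the last entry

swap : ℕ → ℕ → ℕ
swap k v with v ≟ k | v ≟ suc k
... | yes _ | _     = suc k
... | no _  | yes _ = k
... | no _  | no _  = v

swap-self : ∀ k → swap k k ≡ suc k
swap-self k with k ≟ k | k ≟ suc k
... | yes _  | _ = refl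
... | no k≢k | _ = contradiction refl k≢k

swap-suc : ∀ k → swap k (suc k) ≡ k
swap-suc k with suc k ≟ k | suc k ≟ suc k
... | yes 1+k≡k | _        = contradiction 1+k≡k 1+n≢n
... | no _      | yes _    = refl
... | no _      | no ¬refl = contradiction refl ¬refl

swap-other : ∀ {k v} → v ≢ k → v ≢ suc k → swap k v ≡ v
swap-other {k} {v} v≢k v≢1+k with v ≟ k | v ≟ suc k
... | yes v≡k | _         = contradiction v≡k v≢k
... | no _    | yes v≡1+k = contradiction v≡1+k v≢1+k
... | no _    | no _      = refl

swap-below : ∀ {k v} → v < k → swap k v ≡ v
swap-below v<k = swap-other (<⇒≢ v<k) (<⇒≢ (m<n⇒m<1+n v<k))

swap-involutive : ∀ k v → swap k (swap k v) ≡ v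
swap-involutive k v with v ≟ k | v ≟ suc k
... | yes refl | _        = swap-suc k
... | no _     | yes refl = swap-self k
... | no v≢k   | no v≢1+k = swap-other v≢k v≢1+k

swap-monotone : ∀ {k v w} → v < w → w ≤ k → swap k v < swap k w
swap-monotone {k} {v} {w} v<w w≤k with m≤n⇒m<n∨m≡n w≤k
... | inj₁ w<k  = subst₂ _<_ (sym (swap-below (<-trans v<w w<k))) (sym (swap-below w<k)) v<w
... | inj₂ refl = subst₂ _<_ (sym (swap-below v<w)) (sym (swap-self w)) (m<n⇒m<1+n v<w)

swap-above : ∀ {k v} → v ≤ k → k < swap k v → swap k v ≡ suc k
swap-above {k} {v} v≤k k<swap with m≤n⇒m<n∨m≡n v≤k
... | inj₁ v<k  = contradiction (subst (k <_) (swap-below v<k) k<swap) (<⇒≯ v<k)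
... | inj₂ refl = swap-self v

swap-moves-above : ∀ k v → swap k v ≡ v ⊎ (k ≤ v × k ≤ swap k v)
swap-moves-above k v with v ≟ k | v ≟ suc k
... | yes refl | _        = inj₂ (≤-refl , n≤1+n k)
... | no _     | yes refl = inj₂ (n≤1+n k , ≤-refl)
... | no _     | no _     = inj₁ refl

map-swap-involutive : ∀ k σ → map (swap k) (map (swap k) σ) ≡ σ
map-swap-involutive k σ = trans (sym (map-∘ σ)) (trans (map-cong (swap-involutive k) σ) (map-id σ))

map-swap-below : ∀ {k σ} → All (_< k) σ → map (swap k) σ ≡ σ
map-swap-below σ<k = map-id-local (All.map swap-below σ<k)

map-swap-∷ʳ-self : ∀ k σ → map (swap k) (σ ∷ʳ k) ≡ map (swap k) σ ∷ʳ suc k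
map-swap-∷ʳ-self k σ = trans (map-++ (swap k) σ [ k ]) (cong (map (swap k) σ ∷ʳ_) (swap-self k))

map-swap-oneTo : ∀ j → map (swap (suc j)) (oneTo (suc (suc j))) ↭ oneTo (suc (suc j))
map-swap-oneTo j = begin
  map (swap k) (oneTo (suc k))                             ≡⟨ cong (map (swap k)) (oneTo-suc-suc j) ⟩
  map (swap k) (oneTo j ++ k ∷ suc k ∷ [])                 ≡⟨ map-++ (swap k) (oneTo j) _ ⟩
  map (swap k) (oneTo j) ++ swap k k ∷ swap k (suc k) ∷ []
    ≡⟨ cong₂ _++_ oneTo-fixed (cong₂ (λ a b → [ a ] ∷ʳ b) (swap-self k) (swap-suc k)) ⟩
  oneTo j ++ suc k ∷ k ∷ []                                ↭⟨ ++⁺ˡ (oneTo j) (↭-swap _ _ ↭-refl) ⟩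
  oneTo j ++ k ∷ suc k ∷ []                                ≡⟨ oneTo-suc-suc j ⟨
  oneTo (suc k)                                            ∎
  where
  open PermutationReasoning
  k = suc j
  oneTo-fixed : map (swap k) (oneTo j) ≡ oneTo j
  oneTo-fixed = map-swap-below (All.tabulate (s≤s ∘ ↭-oneTo⇒≤ ↭-refl))

-- σ(k+1) and σ′k in the notation of the header.
appendMax : ℕ → List ℕ → List ℕ
appendMax k σ = σ ∷ʳ suc k

appendSubmax : ℕ → List ℕ → List ℕ
appendSubmax k σ = map (swap k) (appendMax k σ)

appendSubmax-≡ : ∀ k σ → appendSubmax k σ ≡ map (swap k) σ ∷ʳ k
appendSubmax-≡ k σ = trans (map-++ (swap k) σ [ suc k ]) (cong (map (swap k) σ ∷ʳ_) (swap-suc k))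

appendSubmax-swap : ∀ k σ → appendSubmax k (map (swap k) σ) ≡ σ ∷ʳ k
appendSubmax-swap k σ = trans (appendSubmax-≡ k _) (cong (_∷ʳ k) (map-swap-involutive k σ))

appendSubmax-appendMax : ∀ {k σ} → All (_≤ k) σ →
                         appendSubmax (suc k) (appendMax k σ) ≡ σ ∷ʳ suc (suc k) ∷ʳ suc k
appendSubmax-appendMax {k} {σ} σ≤k = begin
  appendSubmax (suc k) (appendMax k σ)                  ≡⟨ appendSubmax-≡ (suc k) (appendMax k σ) ⟩
  map (swap (suc k)) (σ ∷ʳ suc k) ∷ʳ suc k              ≡⟨ cong (_∷ʳ suc k) (map-swap-∷ʳ-self (suc k) σ) ⟩
  map (swap (suc k)) σ ∷ʳ suc (suc k) ∷ʳ suc k          ≡⟨ cong (λ τ → τ ∷ʳ suc (suc k) ∷ʳ suc k)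
                                                                (map-swap-below (All.map s≤s σ≤k)) ⟩
  σ ∷ʳ suc (suc k) ∷ʳ suc k                             ∎
  where open ≡-Reasoning

appendSubmax-appendSubmax : ∀ k σ → appendSubmax (suc k) (appendSubmax k σ) ≡
                            map (swap (suc k)) (map (swap k) σ) ∷ʳ k ∷ʳ suc k
appendSubmax-appendSubmax k σ = begin
  appendSubmax (suc k) (appendSubmax k σ)               ≡⟨ appendSubmax-≡ (suc k) (appendSubmax k σ) ⟩
  map (swap (suc k)) (appendSubmax k σ) ∷ʳ suc k        ≡⟨ cong (λ τ → map (swap (suc k)) τ ∷ʳ suc k)
                                                                (appendSubmax-≡ k σ) ⟩
  map (swap (suc k)) (ρ ∷ʳ k) ∷ʳ suc k                  ≡⟨ cong (_∷ʳ suc k) (map-++ (swap (suc k)) ρ [ k ]) ⟩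
  map (swap (suc k)) ρ ∷ʳ swap (suc k) k ∷ʳ suc k       ≡⟨ cong (λ v → map (swap (suc k)) ρ ∷ʳ v ∷ʳ suc k)
                                                                (swap-below (n<1+n k)) ⟩
  map (swap (suc k)) ρ ∷ʳ k ∷ʳ suc k                    ∎
  where
  open ≡-Reasoning
  ρ = map (swap k) σ

Avoider : ℕ → List ℕ → Set
Avoider n π = π ↭ oneTo n × Avoids π

swap-monotoneOn : ∀ {k σ} → σ ↭ oneTo k → StrictlyMonotoneOn σ (swap k)
swap-monotoneOn p _ w∈σ v<w = swap-monotone v<w (↭-oneTo⇒≤ p w∈σ)

appendMax-avoider : ∀ {k σ} → Avoider k σ → Avoider (suc k) (appendMax k σ)
appendMax-avoider {k} (p , av) = Equivalence.from ∷ʳ-↭-oneTo⇔ p , Equivalence.from avoids-∷ʳ⇔ (av , noneAbove)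
  where
  noneAbove : AtMostOneAbove (suc k) _
  noneAbove a∈σ _ 1+k<a _ = contradiction (↭-oneTo⇒≤ p a∈σ) (<⇒≱ (<-trans (n<1+n k) 1+k<a))

appendSubmax-avoider : ∀ {j σ} → Avoider (suc j) σ → Avoider (suc (suc j)) (appendSubmax (suc j) σ)
appendSubmax-avoider {j} {σ} (p , av) =
  ↭-trans (map⁺ (swap k) (proj₁ (appendMax-avoider (p , av)))) (map-swap-oneTo j) ,
  subst Avoids (sym (appendSubmax-≡ k σ))
        (Equivalence.from avoids-∷ʳ⇔ (Equivalence.to (avoids-map⇔ (swap-monotoneOn p)) av , atMostOne))
  where
  k = suc j
  isTop : ∀ {a} → a ∈ map (swap k) σ → k < a → a ≡ suc k
  isTop a∈ k<a with ∈-map⁻ (swap k) a∈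
  ... | a′ , a′∈σ , refl = swap-above (↭-oneTo⇒≤ p a′∈σ) k<a
  atMostOne : AtMostOneAbove k (map (swap k) σ)
  atMostOne a∈ b∈ k<a k<b = trans (isTop a∈ k<a) (sym (isTop b∈ k<b))

avoider-∷ʳ⁻ : ∀ {j σ v} → Avoider (suc (suc j)) (σ ∷ʳ v) →
              (v ≡ suc (suc j) × Avoider (suc j) σ) ⊎ (v ≡ suc j × Avoider (suc j) (map (swap (suc j)) σ))
avoider-∷ʳ⁻ {j} {σ} {v} (p , av) with Equivalence.to avoids-∷ʳ⇔ av
... | avσ , atMostOne with m≤n⇒m<n∨m≡n (↭-oneTo⇒≤ p (∈-++⁺ʳ σ (here refl)))
...   | inj₂ refl = inj₁ (refl , Equivalence.to ∷ʳ-↭-oneTo⇔ p , avσ)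
...   | inj₁ (s≤s v≤k) with m≤n⇒m<n∨m≡n v≤k
...     | inj₁ v<k  =
    contradiction (atMostOne (inσ (n≤1+n k) v<k) (inσ ≤-refl v<1+k) v<k v<1+k) (<⇒≢ (n<1+n k))
  where
  k = suc j
  v<1+k : v < suc k
  v<1+k = m<n⇒m<1+n v<k
  inσ : ∀ {w} → w ≤ suc k → v < w → w ∈ σ
  inσ w≤ v<w = ∈-∷ʳ⁻ (∈-resp-↭ (↭-sym p) (Equivalence.from ∈-oneTo⇔ (≤-<-trans z≤n v<w , w≤))) (<⇒≢ v<w ∘ sym)
...     | inj₂ refl = inj₂ (refl , τ-perm , Equivalence.from (avoids-map⇔ (swap-monotoneOn τ-perm)) avσ′)
  where
  k = suc j
  τ = map (swap k) σ
  τ-perm : τ ↭ oneTo k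
  τ-perm = Equivalence.to ∷ʳ-↭-oneTo⇔
    (subst (_↭ _) (map-swap-∷ʳ-self k σ) (↭-trans (map⁺ (swap k) p) (map-swap-oneTo j)))
  avσ′ : Avoids (map (swap k) τ)
  avσ′ = subst Avoids (sym (map-swap-involutive k σ)) avσ

𝔖 : ℕ → List (List ℕ)
𝔖 = avoiders Σ231-321

∈-𝔖⇔ : ∀ {n π} → (π ∈ 𝔖 n) ⇔ Avoider n π
∈-𝔖⇔ {n} {π} = mk⇔ to from
  where
  to : π ∈ 𝔖 n → Avoider n π
  to π∈ with ∈-filter⁻ (λ π → T? (avoidsAll Σ231-321 π)) {xs = perms n} π∈
  ... | π∈perms , t = Equivalence.to ∈-perms⇔ π∈perms , Equivalence.to (avoidsAll⇔Avoids π) t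
  from : Avoider n π → π ∈ 𝔖 n
  from (p , av) = ∈-filter⁺ (λ π → T? (avoidsAll Σ231-321 π))
    (Equivalence.from ∈-perms⇔ p) (Equivalence.from (avoidsAll⇔Avoids π) av)

𝔖-unique : ∀ n → Unique (𝔖 n)
𝔖-unique n = Unique.filter⁺ (λ π → T? (avoidsAll Σ231-321 π))
  (Unique.filter⁺ (λ w → T? (distinct w)) (words-unique n n))

appendMax-injective : ∀ {k σ τ} → appendMax k σ ≡ appendMax k τ → σ ≡ τ
appendMax-injective {σ = σ} {τ} = ∷ʳ-injectiveˡ σ τ

appendSubmax-injective : ∀ {k σ τ} → appendSubmax k σ ≡ appendSubmax k τ → σ ≡ τ
appendSubmax-injective {k} eq = appendMax-injective
  (trans (sym (map-swap-involutive k _)) (trans (cong (map (swap k)) eq) (map-swap-involutive k _)))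

appendMax≢appendSubmax : ∀ {k σ τ} → appendMax k σ ≢ appendSubmax k τ
appendMax≢appendSubmax {k} {σ} {τ} eq =
  1+n≢n (∷ʳ-injectiveʳ σ (map (swap k) τ) (trans eq (appendSubmax-≡ k τ)))

𝔖-suc-↭ : ∀ j → let k = suc j in 𝔖 (suc k) ↭ map (appendMax k) (𝔖 k) ++ map (appendSubmax k) (𝔖 k)
𝔖-suc-↭ j = ∼bag⇒↭ (unique∧set⇒bag (𝔖-unique (suc k)) rhs-unique (mk⇔ to from))
  where
  k = suc j
  rhs = map (appendMax k) (𝔖 k) ++ map (appendSubmax k) (𝔖 k)
  disjoint : Disjoint (map (appendMax k) (𝔖 k)) (map (appendSubmax k) (𝔖 k))
  disjoint (p , q) with ∈-map⁻ (appendMax k) p | ∈-map⁻ (appendSubmax k) q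
  ... | _ , _ , refl | _ , _ , eq = appendMax≢appendSubmax eq
  rhs-unique : Unique rhs
  rhs-unique = Unique.++⁺ (Unique.map⁺ appendMax-injective (𝔖-unique k))
                          (Unique.map⁺ appendSubmax-injective (𝔖-unique k)) disjoint
  to : ∀ {π} → π ∈ 𝔖 (suc k) → π ∈ rhs
  to {π} π∈ with reverseView π | Equivalence.to (∈-𝔖⇔ {suc k}) π∈
  ... | []          | p , _ = contradiction (↭-length p) λ ()
  ... | σ ∶ _ ∶ʳ v | a with avoider-∷ʳ⁻ {j} a
  ...   | inj₁ (refl , aσ) = ∈-++⁺ˡ (∈-map⁺ (appendMax k) (Equivalence.from ∈-𝔖⇔ aσ))
  ...   | inj₂ (refl , aτ) = ∈-++⁺ʳ (map (appendMax k) (𝔖 k))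
    (subst (_∈ _) (appendSubmax-swap k σ) (∈-map⁺ (appendSubmax k) (Equivalence.from ∈-𝔖⇔ aτ)))
  from : ∀ {π} → π ∈ rhs → π ∈ 𝔖 (suc k)
  from π∈ with ∈-++⁻ (map (appendMax k) (𝔖 k)) π∈
  ... | inj₁ p with ∈-map⁻ (appendMax k) p
  ...   | _ , σ∈ , refl = Equivalence.from ∈-𝔖⇔ (appendMax-avoider (Equivalence.to ∈-𝔖⇔ σ∈))
  from π∈ | inj₂ q with ∈-map⁻ (appendSubmax k) q
  ...   | _ , σ∈ , refl = Equivalence.from ∈-𝔖⇔ (appendSubmax-avoider (Equivalence.to ∈-𝔖⇔ σ∈))

-- Fixed points and excedances

count-∷ʳ : ∀ P xs z → count P (xs ∷ʳ z) ≡ (if P z then suc (count P xs) else count P xs)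
count-∷ʳ P []       z = refl
count-∷ʳ P (x ∷ xs) z with P x | P z | count-∷ʳ P xs z
... | true  | true  | ih = cong suc ih
... | true  | false | ih = cong suc ih
... | false | _     | ih = ih

zip-∷ʳ : ∀ {xs : List A} {ys : List B} {x y} → length xs ≡ length ys →
         zip (xs ∷ʳ x) (ys ∷ʳ y) ≡ zip xs ys ∷ʳ (x , y)
zip-∷ʳ {xs = []}     {[]}     refl = refl
zip-∷ʳ {xs = x ∷ xs} {y ∷ ys} eq   = cong ((x , y) ∷_) (zip-∷ʳ (suc-injective eq))

length-∷ʳ : ∀ (xs : List A) x → length (xs ∷ʳ x) ≡ suc (length xs)
length-∷ʳ xs x = trans (length-++ xs) (+-comm (length xs) 1)

indexed-∷ʳ : ∀ σ c → indexed (σ ∷ʳ c) ≡ indexed σ ∷ʳ (c , suc (length σ))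
indexed-∷ʳ σ c = begin
  zip (σ ∷ʳ c) (oneTo (length (σ ∷ʳ c)))            ≡⟨ cong (zip (σ ∷ʳ c) ∘ oneTo) (length-∷ʳ σ c) ⟩
  zip (σ ∷ʳ c) (oneTo (suc (length σ)))             ≡⟨ cong (zip (σ ∷ʳ c)) (oneTo-suc (length σ)) ⟩
  zip (σ ∷ʳ c) (oneTo (length σ) ∷ʳ suc (length σ)) ≡⟨ zip-∷ʳ (sym (length-oneTo (length σ))) ⟩
  indexed σ ∷ʳ (c , suc (length σ))                 ∎
  where open ≡-Reasoning

count-indexed-∷ʳ : ∀ P σ c → count P (indexed (σ ∷ʳ c)) ≡
                   (if P (c , suc (length σ)) then suc (count P (indexed σ)) else count P (indexed σ))
count-indexed-∷ʳ P σ c = trans (cong (count P) (indexed-∷ʳ σ c)) (count-∷ʳ P (indexed σ) _)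

count-indexed-map : ∀ P (f : ℕ → ℕ) σ → (∀ v {i} → i ≤ length σ → P (f v , i) ≡ P (v , i)) →
                    count P (indexed (map f σ)) ≡ count P (indexed σ)
count-indexed-map P f σ = go (reverseView σ)
  where
  go : ∀ {σ} → Reverse σ → (∀ v {i} → i ≤ length σ → P (f v , i) ≡ P (v , i)) →
       count P (indexed (map f σ)) ≡ count P (indexed σ)
  go []           _     = refl
  go (ρ ∶ r ∶ʳ a) agree = begin
    count P (indexed (map f (ρ ∷ʳ a)))         ≡⟨ cong (count P ∘ indexed) (map-++ f ρ [ a ]) ⟩
    count P (indexed (map f ρ ∷ʳ f a))         ≡⟨ count-indexed-∷ʳ P (map f ρ) (f a) ⟩
    (if P (f a , suc (length (map f ρ))) then suc (count P (indexed (map f ρ))) else count P (indexed (map f ρ)))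
      ≡⟨ cong₂ (λ b m → if b then suc m else m) last (go r (λ v i≤ → agree v (≤-trans i≤ ρ≤))) ⟩
    (if P (a , suc (length ρ)) then suc (count P (indexed ρ)) else count P (indexed ρ))
      ≡⟨ count-indexed-∷ʳ P ρ a ⟨
    count P (indexed (ρ ∷ʳ a))                 ∎
    where
    open ≡-Reasoning
    ρ≤ : length ρ ≤ length (ρ ∷ʳ a)
    ρ≤ = ≤-trans (n≤1+n _) (≤-reflexive (sym (length-∷ʳ ρ a)))
    last : P (f a , suc (length (map f ρ))) ≡ P (a , suc (length ρ))
    last = trans (cong (λ m → P (f a , suc m)) (length-map f ρ)) (agree a (≤-reflexive (sym (length-∷ʳ ρ a))))

fp-∷ʳ-fixed : ∀ σ → fp (σ ∷ʳ suc (length σ)) ≡ suc (fp σ)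
fp-∷ʳ-fixed σ =
  trans (count-indexed-∷ʳ _ σ _) (cong (if_then suc (fp σ) else fp σ) (≡ᵇ-true {length σ} refl))

fp-∷ʳ-unfixed : ∀ σ {c} → c ≢ suc (length σ) → fp (σ ∷ʳ c) ≡ fp σ
fp-∷ʳ-unfixed σ c≢ =
  trans (count-indexed-∷ʳ _ σ _) (cong (if_then suc (fp σ) else fp σ) (≡ᵇ-false c≢))

exc-∷ʳ-excedance : ∀ σ {c} → suc (length σ) < c → exc (σ ∷ʳ c) ≡ suc (exc σ)
exc-∷ʳ-excedance σ i<c =
  trans (count-indexed-∷ʳ _ σ _) (cong (if_then suc (exc σ) else exc σ) (<ᵇ-true i<c))

exc-∷ʳ-nonexcedance : ∀ σ {c} → c ≤ suc (length σ) → exc (σ ∷ʳ c) ≡ exc σ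
exc-∷ʳ-nonexcedance σ c≤i =
  trans (count-indexed-∷ʳ _ σ _) (cong (if_then suc (exc σ) else exc σ) (<ᵇ-false c≤i))

-- fp and exc compare entries only with positions, which never exceed the length.
MovesOnlyAbove : ℕ → (ℕ → ℕ) → Set
MovesOnlyAbove n f = ∀ v → f v ≡ v ⊎ (n < v × n < f v)

swap-movesOnlyAbove : ∀ {n k} → n < k → MovesOnlyAbove n (swap k)
swap-movesOnlyAbove {n} {k} n<k v with swap-moves-above k v
... | inj₁ fixed          = inj₁ fixed
... | inj₂ (k≤v , k≤swap) = inj₂ (<-≤-trans n<k k≤v , <-≤-trans n<k k≤swap)

fp-map : ∀ {f} σ → MovesOnlyAbove (length σ) f → fp (map f σ) ≡ fp σ
fp-map {f} σ moves = count-indexed-map _ f σ agree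
  where
  agree : ∀ v {i} → i ≤ length σ → (f v ≡ᵇ i) ≡ (v ≡ᵇ i)
  agree v i≤ with moves v
  ... | inj₁ fv≡v         = cong (_≡ᵇ _) fv≡v
  ... | inj₂ (n<v , n<fv) = trans (≡ᵇ-false (<⇒≢ (≤-<-trans i≤ n<fv) ∘ sym))
                                  (sym (≡ᵇ-false (<⇒≢ (≤-<-trans i≤ n<v) ∘ sym)))

exc-map : ∀ {f} σ → MovesOnlyAbove (length σ) f → exc (map f σ) ≡ exc σ
exc-map {f} σ moves = count-indexed-map _ f σ agree
  where
  agree : ∀ v {i} → i ≤ length σ → (i <ᵇ f v) ≡ (i <ᵇ v)
  agree v i≤ with moves v
  ... | inj₁ fv≡v         = cong (_ <ᵇ_) fv≡v
  ... | inj₂ (n<v , n<fv) = trans (<ᵇ-true (≤-<-trans i≤ n<fv)) (sym (<ᵇ-true (≤-<-trans i≤ n<v)))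

-- The recurrence

module _ {c ℓ} (R : CommutativeRing c ℓ) where
  open CommutativeRing R renaming (refl to ≈-refl; sym to ≈-sym; trans to ≈-trans)
  open import Relation.Binary.Reasoning.Setoid setoid

  sumOver : (A → Carrier) → List A → Carrier
  sumOver w = foldr (λ a s → w a + s) 0#

  sumOver-++ : ∀ (w : A → Carrier) xs ys → sumOver w (xs ++ ys) ≈ sumOver w xs + sumOver w ys
  sumOver-++ w []       ys = ≈-sym (+-identityˡ _)
  sumOver-++ w (x ∷ xs) ys = ≈-trans (+-congˡ (sumOver-++ w xs ys)) (≈-sym (+-assoc _ _ _))

  sumOver-map : ∀ (w : B → Carrier) (f : A → B) xs → sumOver w (map f xs) ≡ sumOver (w ∘ f) xs
  sumOver-map w f = foldr-map _ f 0#

  sumOver-cong : ∀ {w w′ : A → Carrier} xs → (∀ {a} → a ∈ xs → w a ≈ w′ a) → sumOver w xs ≈ sumOver w′ xs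
  sumOver-cong []       _  = ≈-refl
  sumOver-cong (x ∷ xs) eq = +-cong (eq (here refl)) (sumOver-cong xs (eq ∘ there))

  sumOver-*ˡ : ∀ k (w : A → Carrier) xs → sumOver (λ a → k * w a) xs ≈ k * sumOver w xs
  sumOver-*ˡ k w []       = ≈-sym (zeroʳ k)
  sumOver-*ˡ k w (x ∷ xs) = ≈-trans (+-congˡ (sumOver-*ˡ k w xs)) (≈-sym (distribˡ k _ _))

  sumOver-↭ : ∀ (w : A → Carrier) {xs ys} → xs ↭ ys → sumOver w xs ≈ sumOver w ys
  sumOver-↭ w {xs} {ys} p = begin
    sumOver w xs            ≡⟨ foldr-map _+_ w 0# xs ⟨
    foldr _+_ 0# (map w xs) ≈⟨ Permutationₛ.foldr-commMonoid setoid +-isCommutativeMonoid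
                                 (↭⇒↭ₛ′ isEquivalence (map⁺ w p)) ⟩
    foldr _+_ 0# (map w ys) ≡⟨ foldr-map _+_ w 0# ys ⟩
    sumOver w ys            ∎

module Recurrence {c ℓ} (R : CommutativeRing c ℓ) (x q : CommutativeRing.Carrier R) where
  open CommutativeRing R hiding (zero) renaming (refl to ≈-refl; sym to ≈-sym; trans to ≈-trans)
  open import Relation.Binary.Reasoning.Setoid setoid
  open import Algebra.Properties.CommutativeSemigroup +-commutativeSemigroup using (interchange; xy∙z≈zy∙x)
  open import Algebra.Properties.CommutativeSemigroup *-commutativeSemigroup using (x∙yz≈y∙xz)
  open import Algebra.Properties.AbelianGroup +-abelianGroup using (⁻¹-∙-comm; ⁻¹-anti-homo‿-; xyx⁻¹≈y)
  open import Algebra.Properties.Group +-group using (x≈y⇒x∙y⁻¹≈ε)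
  open import Algebra.Properties.Ring ring using (-‿distribˡ-*)

  weight : List ℕ → Carrier
  weight π = pow R x (fp π) * pow R q (exc π)

  F : ℕ → Carrier
  F = Fcoef R Σ231-321 x q

  G : ℕ → Carrier
  G k = sumOver R (weight ∘ appendSubmax k) (𝔖 k)

  weight-≡ : ∀ π {m n} → fp π ≡ m → exc π ≡ n → weight π ≡ pow R x m * pow R q n
  weight-≡ π = cong₂ (λ m n → pow R x m * pow R q n)

  weight-∷ʳ-fixed : ∀ σ → weight (σ ∷ʳ suc (length σ)) ≈ x * weight σ
  weight-∷ʳ-fixed σ = begin
    weight (σ ∷ʳ suc (length σ))           ≡⟨ weight-≡ (σ ∷ʳ _) (fp-∷ʳ-fixed σ) (exc-∷ʳ-nonexcedance σ ≤-refl) ⟩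
    (x * pow R x (fp σ)) * pow R q (exc σ) ≈⟨ *-assoc _ _ _ ⟩
    x * weight σ                           ∎

  weight-∷ʳ-excedance : ∀ σ {c} → suc (length σ) < c → weight (σ ∷ʳ c) ≈ q * weight σ
  weight-∷ʳ-excedance σ i<c = begin
    weight (σ ∷ʳ _)                        ≡⟨ weight-≡ (σ ∷ʳ _) (fp-∷ʳ-unfixed σ (<⇒≢ i<c ∘ sym))
                                                                 (exc-∷ʳ-excedance σ i<c) ⟩
    pow R x (fp σ) * (q * pow R q (exc σ)) ≈⟨ x∙yz≈y∙xz _ _ _ ⟩
    q * weight σ                           ∎

  weight-∷ʳ-deficiency : ∀ σ {c} → c ≤ length σ → weight (σ ∷ʳ c) ≡ weight σ
  weight-∷ʳ-deficiency σ c≤ =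
    weight-≡ (σ ∷ʳ _) (fp-∷ʳ-unfixed σ (<⇒≢ (s≤s c≤))) (exc-∷ʳ-nonexcedance σ (m≤n⇒m≤1+n c≤))

  weight-map : ∀ {f} σ → MovesOnlyAbove (length σ) f → weight (map f σ) ≡ weight σ
  weight-map {f} σ moves = weight-≡ (map f σ) (fp-map σ moves) (exc-map σ moves)

  weight-appendMax : ∀ {k σ} → length σ ≡ k → weight (appendMax k σ) ≈ x * weight σ
  weight-appendMax {σ = σ} refl = weight-∷ʳ-fixed σ

  weight-appendSubmax-appendMax : ∀ {k σ} → σ ↭ oneTo k →
                                  weight (appendSubmax (suc k) (appendMax k σ)) ≈ q * weight σ
  weight-appendSubmax-appendMax {k} {σ} p with ↭-oneTo⇒length p
  ... | refl = begin
    weight (appendSubmax (suc k) (appendMax k σ)) ≡⟨ cong weight (appendSubmax-appendMax σ≤k) ⟩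
    weight (σ ∷ʳ suc (suc k) ∷ʳ suc k)            ≡⟨ weight-∷ʳ-deficiency (σ ∷ʳ suc (suc k))
                                                                          (≤-reflexive (sym (length-∷ʳ σ _))) ⟩
    weight (σ ∷ʳ suc (suc k))                     ≈⟨ weight-∷ʳ-excedance σ ≤-refl ⟩
    q * weight σ                                  ∎
    where
    σ≤k : All (_≤ k) σ
    σ≤k = All.tabulate (↭-oneTo⇒≤ p)

  weight-appendSubmax² : ∀ {k σ} → length σ ≡ k →
                         weight (appendSubmax (suc k) (appendSubmax k σ)) ≈ weight (appendSubmax k σ)
  weight-appendSubmax² {k} {σ} length≡k = begin
    weight (appendSubmax (suc k) (appendSubmax k σ)) ≡⟨ cong weight (appendSubmax-appendSubmax k σ) ⟩
    weight (ρ′ ∷ʳ k ∷ʳ suc k)                        ≡⟨ weight-∷ʳ-deficiency (ρ′ ∷ʳ k) (≤-reflexive (sym ρ′k-length)) ⟩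
    weight (ρ′ ∷ʳ k)                                 ≡⟨ weight-∷ʳ-deficiency ρ′ (≤-reflexive (sym ρ′-length)) ⟩
    weight ρ′                                        ≡⟨ weight-map ρ (swap-movesOnlyAbove (s≤s (≤-reflexive ρ-length))) ⟩
    weight ρ                                         ≡⟨ weight-∷ʳ-deficiency ρ (≤-reflexive (sym ρ-length)) ⟨
    weight (ρ ∷ʳ k)                                  ≡⟨ cong weight (appendSubmax-≡ k σ) ⟨
    weight (appendSubmax k σ)                        ∎
    where
    ρ = map (swap k) σ
    ρ′ = map (swap (suc k)) ρ
    ρ-length : length ρ ≡ k
    ρ-length = trans (length-map (swap k) σ) length≡k
    ρ′-length : length ρ′ ≡ k
    ρ′-length = trans (length-map (swap (suc k)) ρ) ρ-length
    ρ′k-length : length (ρ′ ∷ʳ k) ≡ suc k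
    ρ′k-length = trans (length-∷ʳ ρ′ k) (cong suc ρ′-length)

  sumOver-𝔖-suc : ∀ (w : List ℕ → Carrier) j → let k = suc j in
                  sumOver R w (𝔖 (suc k)) ≈
                  sumOver R (w ∘ appendMax k) (𝔖 k) + sumOver R (w ∘ appendSubmax k) (𝔖 k)
  sumOver-𝔖-suc w j = begin
    sumOver R w (𝔖 (suc k))
      ≈⟨ sumOver-↭ R w (𝔖-suc-↭ j) ⟩
    sumOver R w (map (appendMax k) (𝔖 k) ++ map (appendSubmax k) (𝔖 k))
      ≈⟨ sumOver-++ R w (map (appendMax k) (𝔖 k)) _ ⟩
    sumOver R w (map (appendMax k) (𝔖 k)) + sumOver R w (map (appendSubmax k) (𝔖 k))
      ≡⟨ cong₂ _+_ (sumOver-map R w (appendMax k) (𝔖 k)) (sumOver-map R w (appendSubmax k) (𝔖 k)) ⟩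
    sumOver R (w ∘ appendMax k) (𝔖 k) + sumOver R (w ∘ appendSubmax k) (𝔖 k) ∎
    where k = suc j

  F-suc : ∀ j → F (suc (suc j)) ≈ x * F (suc j) + G (suc j)
  F-suc j = begin
    F (suc k)                                    ≈⟨ sumOver-𝔖-suc weight j ⟩
    sumOver R (weight ∘ appendMax k) (𝔖 k) + G k ≈⟨ +-congʳ (sumOver-cong R (𝔖 k) λ {σ} σ∈ →
                                                      weight-appendMax {σ = σ} (↭-oneTo⇒length (perm σ∈))) ⟩
    sumOver R (λ σ → x * weight σ) (𝔖 k) + G k   ≈⟨ +-congʳ (sumOver-*ˡ R x weight (𝔖 k)) ⟩
    x * F k + G k                                ∎
    where
    k = suc j
    perm : ∀ {σ} → σ ∈ 𝔖 k → σ ↭ oneTo k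
    perm = proj₁ ∘ Equivalence.to ∈-𝔖⇔

  G-suc : ∀ j → G (suc (suc j)) ≈ q * F (suc j) + G (suc j)
  G-suc j = begin
    G (suc k)                                    ≈⟨ sumOver-𝔖-suc (weight ∘ appendSubmax (suc k)) j ⟩
    sumOver R (weight ∘ appendSubmax (suc k) ∘ appendMax k) (𝔖 k) +
    sumOver R (weight ∘ appendSubmax (suc k) ∘ appendSubmax k) (𝔖 k)
      ≈⟨ +-cong (sumOver-cong R (𝔖 k) λ {σ} σ∈ → weight-appendSubmax-appendMax {σ = σ} (perm σ∈))
                (sumOver-cong R (𝔖 k) λ {σ} σ∈ → weight-appendSubmax² {σ = σ} (↭-oneTo⇒length (perm σ∈))) ⟩
    sumOver R (λ σ → q * weight σ) (𝔖 k) + G k   ≈⟨ +-congʳ (sumOver-*ˡ R q weight (𝔖 k)) ⟩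
    q * F k + G k                                ∎
    where
    k = suc j
    perm : ∀ {σ} → σ ∈ 𝔖 k → σ ↭ oneTo k
    perm = proj₁ ∘ Equivalence.to ∈-𝔖⇔

  F-zero : F 0 ≈ 1#
  F-zero = ≈-trans (+-identityʳ _) (*-identityˡ _)

  F-one : F 1 ≈ x
  F-one = ≈-trans (+-identityʳ _) (≈-trans (*-identityʳ _) (*-identityʳ x))

  F-one-expanded : F 1 ≈ x * F 0 + 0#
  F-one-expanded = ≈-trans F-one (≈-sym (≈-trans (+-identityʳ _) (≈-trans (*-congˡ F-zero) (*-identityʳ x))))

  F-two-expanded : F 2 ≈ x * F 1 + (q * F 0 + 0#)
  F-two-expanded = +-cong (≈-trans (*-assoc _ _ _) (*-congˡ (≈-sym (+-identityʳ _))))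
                          (+-congʳ (≈-trans (*-identityˡ _) (*-congˡ (≈-sym F-zero))))

  recurrence-step : ∀ {a b c g g′} → a ≈ x * b + g′ → g′ ≈ q * c + g → b ≈ x * c + g →
                    a + x * c ≈ (x + 1#) * b + q * c
  recurrence-step {a} {b} {c} {g} a≈ g′≈ b≈ = begin
    a + x * c                     ≈⟨ +-congʳ (≈-trans a≈ (+-congˡ g′≈)) ⟩
    (x * b + (q * c + g)) + x * c ≈⟨ +-assoc _ _ _ ⟩
    x * b + ((q * c + g) + x * c) ≈⟨ +-congˡ (xy∙z≈zy∙x _ _ _) ⟩
    x * b + ((x * c + g) + q * c) ≈⟨ +-assoc _ _ _ ⟨
    (x * b + (x * c + g)) + q * c ≈⟨ +-congʳ (+-congˡ b≈) ⟨
    (x * b + b) + q * c           ≈⟨ +-congʳ (+-congˡ (*-identityˡ b)) ⟨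
    (x * b + 1# * b) + q * c      ≈⟨ +-congʳ (distribʳ b x 1#) ⟨
    (x + 1#) * b + q * c          ∎

  F-recurrence : ∀ n → F (suc (suc n)) + x * F n ≈ (x + 1#) * F (suc n) + q * F n
  F-recurrence zero    = recurrence-step F-two-expanded ≈-refl F-one-expanded
  F-recurrence (suc j) = recurrence-step (F-suc (suc j)) (G-suc j) (F-suc j)

  rearranged-to-zero : ∀ {a b c} → a + x * c ≈ (x + 1#) * b + q * c → a - (x + 1#) * b + (x - q) * c ≈ 0#
  rearranged-to-zero {a} {b} {c} eq = begin
    a - (x + 1#) * b + (x - q) * c           ≈⟨ +-congˡ (≈-trans (distribʳ c x (- q))
                                                                  (+-congˡ (≈-sym (-‿distribˡ-* q c)))) ⟩
    (a - (x + 1#) * b) + (x * c - q * c)     ≈⟨ interchange _ _ _ _ ⟩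
    (a + x * c) + (- ((x + 1#) * b) - q * c) ≈⟨ +-congˡ (⁻¹-∙-comm _ _) ⟩
    (a + x * c) - ((x + 1#) * b + q * c)     ≈⟨ x≈y⇒x∙y⁻¹≈ε eq ⟩
    0#                                       ∎

  initial-condition : F 1 - (x + 1#) * F 0 ≈ - 1#
  initial-condition = begin
    F 1 - (x + 1#) * F 0 ≈⟨ +-cong F-one (-‿cong (≈-trans (*-congˡ F-zero) (*-identityʳ _))) ⟩
    x - (x + 1#)         ≈⟨ ⁻¹-anti-homo‿- (x + 1#) x ⟨
    - ((x + 1#) - x)     ≈⟨ -‿cong (xyx⁻¹≈y x 1#) ⟩
    - 1#                 ∎

corollary4p4 : ∀ {c ℓ} (R : CommutativeRing c ℓ) (x q : CommutativeRing.Carrier R) →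
    let open CommutativeRing R
        f = Fcoef R Σ231-321 x q
    in (f 0 ≈ 1#)
       × (f 1 - (x + 1#) * f 0 ≈ - 1#)
       × (∀ (n : ℕ) → f (suc (suc n)) - (x + 1#) * f (suc n) + (x - q) * f n ≈ 0#)
corollary4p4 R x q = F-zero , initial-condition , λ n → rearranged-to-zero (F-recurrence n)
  where open Recurrence R x q
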